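{- Let $Y$ be a Young diagram with row lengths $a_1\ge\cdots\ge a_m\ge 0$, let $P\subseteq (C\times S)\cup(R\times S)\cup(R\times C)$, and let $Q=P\cap(C\times S)$, $W=P\cap(R\times C)$. For $1\le i<j\le a_1$ let $P'=\phi_{c_i,c_j}(P)$ be obtained from $P$ by removing all pairs containing $c_i$ or $c_j$ and adding \[\{c_i\}\times\big(N_Q(c_i)\cup N_Q(c_j)\big)\ \cup\ \{c_j\}\times\big(N_Q(c_i)\cap N_Q(c_j)\big)\ \cup\ \{c_i\}\times\Big(N_W(c_i)\cap\big(N_W(c_j)\cup L_j\big)\Big)\ \cup\ \{c_j\}\times\Big(N_W(c_j)\cup\big(N_W(c_i)\setminus L_j\big)\Big).\] Then (1) $|P'|=|P|$, and (2) if $P$ is a 2-cover of $H(Y)$, then so is $P'$.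
   Context: $H(Y)$ is the tripartite 3-uniform hypergraph with sides $R=\{r_1,\dots,r_m\}$, $C=\{c_1,\dots,c_{a_1}\}$, $S=\{s_1,\dots,s_{a_1}\}$ and edge set $\bigcup_{i=1}^m\{\{r_i,c_j,s_k\}: 1\le j,k\le a_i\}$. For disjoint sets $A,B$, $A\times B=\{\{a,b\}: a\in A,b\in B\}$. A 2-cover of $H(Y)$ is a set $P\subseteq (R\times C)\cup(R\times S)\cup(C\times S)$ such that every edge of $H(Y)$ contains at least one pair of $P$. For a graph $G$ (a set of pairs) and a vertex $v$, $N_G(v)$ is the set of vertices $u$ with $\{u,v\}\in G$. For an integer $t$, $L_t=\{r_\ell\in R: a_\ell<t\}$. -}

module Defs where

open import Data.Nat using (ℕ; zero; suc; _+_; _<_; _≤_)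
open import Data.Bool using (Bool; true; false; if_then_else_; _∧_; _∨_; not)
open import Data.Fin using (Fin; toℕ; _≟_)
import Data.Fin as F
open import Data.Sum using (_⊎_)
open import Data.Product using (_×_)
open import Relation.Binary.PropositionalEquality using (_≡_)
open import Relation.Nullary using (does)
open import Data.Nat.Properties using (_<?_)

-- Young diagram with m rows: row lengths a 0 ≥ a 1 ≥ … ≥ a (m-1) ≥ 0
-- (0-indexed; row r_{i+1} of the paper is index i).
NonIncreasing : {m : ℕ} → (Fin m → ℕ) → Set
NonIncreasing {m} a = ∀ (i j : Fin m) → toℕ i ≤ toℕ j → a j ≤ a i

width : (m : ℕ) → (Fin m → ℕ) → ℕ
width zero    a = 0
width (suc m) a = a F.zero

-- A set P ⊆ (R×C) ∪ (R×S) ∪ (C×S), with |R| = m, |C| = |S| = n,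
-- given by its three characteristic functions.
record PairSet (m n : ℕ) : Set where
  constructor pairSet
  field
    rc : Fin m → Fin n → Bool   -- {r,c} ∈ P   (this part is W)
    rs : Fin m → Fin n → Bool
    cs : Fin n → Fin n → Bool   -- {c,s} ∈ P   (this part is Q)
open PairSet public

count : (n : ℕ) → (Fin n → Bool) → ℕ
count zero    f = 0
count (suc n) f = (if f F.zero then 1 else 0) + count n (λ i → f (F.suc i))

count₂ : (k n : ℕ) → (Fin k → Fin n → Bool) → ℕ
count₂ zero    n f = 0
count₂ (suc k) n f = count n (f F.zero) + count₂ k n (λ i → f (F.suc i))

size : {m n : ℕ} → PairSet m n → ℕ
size {m} {n} P = count₂ m n (rc P) + count₂ m n (rs P) + count₂ n n (cs P)

-- P is a 2-cover of H(Y): every edge {r_i, c_j, s_k} with j,k ≤ a_i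
-- (0-indexed: toℕ j < a i, toℕ k < a i) contains a pair of P.
Is2Cover : {m : ℕ} (a : Fin m → ℕ) → PairSet m (width m a) → Set
Is2Cover {m} a P =
  ∀ (i : Fin m) (j k : Fin (width m a)) → toℕ j < a i → toℕ k < a i →
    (rc P i j ≡ true) ⊎ (rs P i k ≡ true) ⊎ (cs P j k ≡ true)

-- r_ℓ ∈ L_t  iff  a_ℓ < t
inL : {m : ℕ} (a : Fin m → ℕ) (t : ℕ) → Fin m → Bool
inL a t ℓ = does (a ℓ <? t)

-- φ_{c_i,c_j}(P).  Columns are 0-indexed, so the paper's L_j for column
-- c_j (paper index toℕ j + 1) is L_(suc (toℕ j)).
φ : {m : ℕ} (a : Fin m → ℕ) (i j : Fin (width m a)) →
    PairSet m (width m a) → PairSet m (width m a)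
φ {m} a i j P = pairSet rc' (rs P) cs'
  where
    Lj : Fin m → Bool
    Lj = inL a (suc (toℕ j))
    cs' : Fin (width m a) → Fin (width m a) → Bool
    cs' c s = if does (c ≟ i) then (cs P i s ∨ cs P j s)
              else if does (c ≟ j) then (cs P i s ∧ cs P j s)
              else cs P c s
    rc' : Fin m → Fin (width m a) → Bool
    rc' r c = if does (c ≟ i) then (rc P r i ∧ (rc P r j ∨ Lj r))
              else if does (c ≟ j) then (rc P r j ∨ (rc P r i ∧ not (Lj r)))
              else rc P r c

-- For each r ∈ R and each s ∈ S it replaces
-- the two bits x = [{r,c_i} ∈ W], y = [{r,c_j} ∈ W] (resp. x = [{c_i,s} ∈ Q],
-- y = [{c_j,s} ∈ Q]) by x ∧ (y ∨ l), y ∨ (x ∧ ¬ l) with l = [r ∈ L_j] (resp. by x ∨ y,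
-- x ∧ y), which have the same sum, so |P| is unchanged.
-- An edge {r, c_i, s} can only lose its pair {r, c_i} when r ∉ L_j; then {r, c_j, s}
-- is also an edge, and its covering pair is inherited by {r, c_i, s}.  An edge
-- {r, c_j, s} can only lose its pair {c_j, s} when {c_i, s} ∉ Q; then it is rescued
-- through the edge {r, c_i, s}, which exists because i < j.
module Submission where

open import Defs
open import Data.Nat using (ℕ; zero; suc; _+_; _<_)
open import Data.Nat.Properties
  using (+-0-commutativeMonoid; +-commutativeSemigroup; +-assoc; +-cancelʳ-≡; _<?_; ≮⇒≥; ≤⇒≯; <-trans)
open import Algebra.Properties.CommutativeMonoid.Sum +-0-commutativeMonoid
  using (sum; sum-cong-≗; ∑-distrib-+)
open import Algebra.Properties.CommutativeSemigroup +-commutativeSemigroup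
  using (xy∙z≈zy∙x; xy∙z≈xz∙y; xy∙z≈x∙zy)
open import Data.Bool using (Bool; true; false; if_then_else_; _∧_; _∨_; not)
open import Data.Bool.Properties using (∨-zeroʳ)
open import Data.Fin using (Fin; toℕ; _≟_)
import Data.Fin as F
open import Data.Fin.Properties using (<⇒≢; suc-injective)
open import Data.Product using (_×_; _,_)
open import Data.Sum using (_⊎_; inj₁; inj₂)
open import Data.Vec.Functional using (Vector; updateAt)
open import Data.Vec.Functional.Properties using (updateAt-updates; updateAt-minimal)
open import Function using (_∘_)
open import Relation.Binary.PropositionalEquality
  using (_≡_; _≢_; refl; sym; trans; cong; cong₂; module ≡-Reasoning)
open import Relation.Nullary using (Dec; yes; no)
open import Relation.Nullary.Decidable using (dec-true; dec-false)

sum-cong-off-point : ∀ {n} (h h′ : Vector ℕ n) (i : Fin n) →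
                     (∀ c → c ≢ i → h c ≡ h′ c) → sum h + h′ i ≡ sum h′ + h i
sum-cong-off-point h h′ F.zero agree = begin
  h F.zero + sum (h ∘ F.suc) + h′ F.zero   ≡⟨ xy∙z≈zy∙x (h F.zero) _ (h′ F.zero) ⟩
  h′ F.zero + sum (h ∘ F.suc) + h F.zero   ≡⟨ cong (λ t → h′ F.zero + t + h F.zero) (sum-cong-≗ tail-agree) ⟩
  h′ F.zero + sum (h′ ∘ F.suc) + h F.zero  ∎
  where
  open ≡-Reasoning
  tail-agree : ∀ c → h (F.suc c) ≡ h′ (F.suc c)
  tail-agree c = agree (F.suc c) λ ()
sum-cong-off-point h h′ (F.suc i) agree = begin
  h F.zero + sum (h ∘ F.suc) + h′ (F.suc i)     ≡⟨ +-assoc (h F.zero) _ _ ⟩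
  h F.zero + (sum (h ∘ F.suc) + h′ (F.suc i))   ≡⟨ cong₂ _+_ (agree F.zero λ ()) (sum-cong-off-point (h ∘ F.suc) (h′ ∘ F.suc) i tail-agree) ⟩
  h′ F.zero + (sum (h′ ∘ F.suc) + h (F.suc i))  ≡⟨ sym (+-assoc (h′ F.zero) _ _) ⟩
  h′ F.zero + sum (h′ ∘ F.suc) + h (F.suc i)    ∎
  where
  open ≡-Reasoning
  tail-agree : ∀ c → c ≢ i → h (F.suc c) ≡ h′ (F.suc c)
  tail-agree c c≢i = agree (F.suc c) (c≢i ∘ suc-injective)

sum-cong-off-pair : ∀ {n} (h h′ : Vector ℕ n) {i j : Fin n} → i ≢ j →
                    (∀ c → c ≢ i → c ≢ j → h c ≡ h′ c) →
                    h i + h j ≡ h′ i + h′ j → sum h ≡ sum h′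
sum-cong-off-pair {n} h h′ {i} {j} i≢j agree pair = +-cancelʳ-≡ (h′ i + h′ j) (sum h) (sum h′) (begin
  sum h + (h′ i + h′ j)    ≡⟨ sym (+-assoc (sum h) _ _) ⟩
  sum h + h′ i + h′ j      ≡⟨ cong (_+ h′ j) step-i ⟩
  sum g + h i + h′ j       ≡⟨ xy∙z≈xz∙y (sum g) _ _ ⟩
  sum g + h′ j + h i       ≡⟨ cong (_+ h i) step-j ⟩
  sum h′ + h j + h i       ≡⟨ xy∙z≈x∙zy (sum h′) _ _ ⟩
  sum h′ + (h i + h j)     ≡⟨ cong (sum h′ +_) pair ⟩
  sum h′ + (h′ i + h′ j)   ∎)
  where
  open ≡-Reasoning
  g : Vector ℕ n
  g = updateAt h i λ _ → h′ i
  step-i : sum h + h′ i ≡ sum g + h i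
  step-i = trans (cong (sum h +_) (sym (updateAt-updates i h)))
                 (sum-cong-off-point h g i λ c c≢i → sym (updateAt-minimal c i h c≢i))
  g-agrees-off-j : ∀ c → c ≢ j → g c ≡ h′ c
  g-agrees-off-j c c≢j with c ≟ i
  ... | yes refl = updateAt-updates i h
  ... | no c≢i   = trans (updateAt-minimal c i h c≢i) (agree c c≢i c≢j)
  step-j : sum g + h′ j ≡ sum h′ + h j
  step-j = trans (sum-cong-off-point g h′ j g-agrees-off-j)
                 (cong (sum h′ +_) (updateAt-minimal j i h (i≢j ∘ sym)))

indicator : Bool → ℕ
indicator b = if b then 1 else 0

count-as-sum : ∀ n (f : Fin n → Bool) → count n f ≡ sum (indicator ∘ f)
count-as-sum zero    f = refl
count-as-sum (suc n) f = cong (indicator (f F.zero) +_) (count-as-sum n (f ∘ F.suc))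

count₂-as-sum : ∀ k n (f : Fin k → Fin n → Bool) → count₂ k n f ≡ sum (count n ∘ f)
count₂-as-sum zero    n f = refl
count₂-as-sum (suc k) n f = cong (count n (f F.zero) +_) (count₂-as-sum k n (f ∘ F.suc))

count-cong : ∀ n {f g : Fin n → Bool} → (∀ s → f s ≡ g s) → count n f ≡ count n g
count-cong n {f} {g} f≗g = begin
  count n f              ≡⟨ count-as-sum n f ⟩
  sum (indicator ∘ f)    ≡⟨ sum-cong-≗ (cong indicator ∘ f≗g) ⟩
  sum (indicator ∘ g)    ≡⟨ count-as-sum n g ⟨
  count n g              ∎
  where open ≡-Reasoning

indicator-∨-∧ : ∀ x y → indicator (x ∨ y) + indicator (x ∧ y) ≡ indicator x + indicator y
indicator-∨-∧ false false = refl
indicator-∨-∧ false true  = refl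
indicator-∨-∧ true  false = refl
indicator-∨-∧ true  true  = refl

indicator-exchange : ∀ x y l → indicator (x ∧ (y ∨ l)) + indicator (y ∨ (x ∧ not l))
                               ≡ indicator x + indicator y
indicator-exchange false false l     = refl
indicator-exchange false true  l     = refl
indicator-exchange true  false false = refl
indicator-exchange true  false true  = refl
indicator-exchange true  true  l     = refl

count-∨-∧ : ∀ n (f g : Fin n → Bool) →
            count n (λ s → f s ∨ g s) + count n (λ s → f s ∧ g s) ≡ count n f + count n g
count-∨-∧ n f g = begin
  count n (λ s → f s ∨ g s) + count n (λ s → f s ∧ g s)
    ≡⟨ cong₂ _+_ (count-as-sum n _) (count-as-sum n _) ⟩
  sum (λ s → indicator (f s ∨ g s)) + sum (λ s → indicator (f s ∧ g s))
    ≡⟨ ∑-distrib-+ (λ s → indicator (f s ∨ g s)) _ ⟨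
  sum (λ s → indicator (f s ∨ g s) + indicator (f s ∧ g s))
    ≡⟨ sum-cong-≗ (λ s → indicator-∨-∧ (f s) (g s)) ⟩
  sum (λ s → indicator (f s) + indicator (g s))
    ≡⟨ ∑-distrib-+ (indicator ∘ f) (indicator ∘ g) ⟩
  sum (indicator ∘ f) + sum (indicator ∘ g)
    ≡⟨ cong₂ _+_ (count-as-sum n f) (count-as-sum n g) ⟨
  count n f + count n g
    ∎
  where open ≡-Reasoning

Covers : ∀ {m n} → PairSet m n → Fin m → Fin n → Fin n → Set
Covers P r c s = (rc P r c ≡ true) ⊎ (rs P r s ≡ true) ⊎ (cs P c s ≡ true)

module _ {m : ℕ} (a : Fin m → ℕ) (P : PairSet m (width m a))
         {i j : Fin (width m a)} (i≢j : i ≢ j) where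

  private
    n = width m a
    P′ = φ a i j P
    Lj = inL a (suc (toℕ j))

  rc-φ-off : ∀ r c → c ≢ i → c ≢ j → rc P′ r c ≡ rc P r c
  rc-φ-off r c c≢i c≢j rewrite dec-false (c ≟ i) c≢i | dec-false (c ≟ j) c≢j = refl

  cs-φ-off : ∀ c s → c ≢ i → c ≢ j → cs P′ c s ≡ cs P c s
  cs-φ-off c s c≢i c≢j rewrite dec-false (c ≟ i) c≢i | dec-false (c ≟ j) c≢j = refl

  rc-φ-pair : ∀ r → indicator (rc P′ r i) + indicator (rc P′ r j)
                    ≡ indicator (rc P r i) + indicator (rc P r j)
  rc-φ-pair r rewrite dec-true (i ≟ i) refl | dec-false (j ≟ i) (i≢j ∘ sym) | dec-true (j ≟ j) refl =
    indicator-exchange (rc P r i) (rc P r j) (Lj r)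

  cs-φ-pair : count n (cs P′ i) + count n (cs P′ j) ≡ count n (cs P i) + count n (cs P j)
  cs-φ-pair rewrite dec-true (i ≟ i) refl | dec-false (j ≟ i) (i≢j ∘ sym) | dec-true (j ≟ j) refl =
    count-∨-∧ n (cs P i) (cs P j)

  size-φ : size P′ ≡ size P
  size-φ = cong₂ (λ w q → w + count₂ m n (rs P) + q) rc-part cs-part
    where
    row : ∀ r → count n (rc P′ r) ≡ count n (rc P r)
    row r = trans (count-as-sum n _) (trans
      (sum-cong-off-pair _ _ i≢j (λ c c≢i c≢j → cong indicator (rc-φ-off r c c≢i c≢j)) (rc-φ-pair r))
      (sym (count-as-sum n _)))
    rc-part : count₂ m n (rc P′) ≡ count₂ m n (rc P)
    rc-part = trans (count₂-as-sum m n _) (trans (sum-cong-≗ row) (sym (count₂-as-sum m n _)))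
    cs-part : count₂ n n (cs P′) ≡ count₂ n n (cs P)
    cs-part = trans (count₂-as-sum n n _) (trans
      (sum-cong-off-pair _ _ i≢j (λ c c≢i c≢j → count-cong n λ s → cs-φ-off c s c≢i c≢j) cs-φ-pair)
      (sym (count₂-as-sum n n _)))

  covers-φ-at-i : ∀ r s → Covers P r i s → (toℕ j < a r → Covers P r j s) → Covers P′ r i s
  covers-φ-at-i r s cov-i cov-j rewrite dec-true (i ≟ i) refl with cov-i
  ... | inj₂ (inj₁ rs-i) = inj₂ (inj₁ rs-i)
  ... | inj₂ (inj₂ cs-i) rewrite cs-i = inj₂ (inj₂ refl)
  ... | inj₁ rc-i rewrite rc-i with rc P r j | a r <? suc (toℕ j)
  ...   | true  | _         = inj₁ refl
  ...   | false | yes r∈Lj rewrite dec-true (a r <? suc (toℕ j)) r∈Lj = inj₁ refl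
  ...   | false | no r∉Lj  with cov-j (≮⇒≥ r∉Lj)
  ...     | inj₁ ()
  ...     | inj₂ (inj₁ rs-j)   = inj₂ (inj₁ rs-j)
  ...     | inj₂ (inj₂ cs-j) rewrite cs-j = inj₂ (inj₂ (∨-zeroʳ (cs P i s)))

  covers-φ-at-j : ∀ r s → toℕ j < a r → Covers P r j s → Covers P r i s → Covers P′ r j s
  covers-φ-at-j r s j<ar cov-j cov-i
    rewrite dec-false (j ≟ i) (i≢j ∘ sym) | dec-true (j ≟ j) refl
          | dec-false (a r <? suc (toℕ j)) (≤⇒≯ j<ar) with cov-j
  ... | inj₁ rc-j rewrite rc-j = inj₁ refl
  ... | inj₂ (inj₁ rs-j) = inj₂ (inj₁ rs-j)
  ... | inj₂ (inj₂ cs-j) rewrite cs-j with cov-i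
  ...   | inj₁ rc-i rewrite rc-i = inj₁ (∨-zeroʳ (rc P r j))
  ...   | inj₂ (inj₁ rs-i) = inj₂ (inj₁ rs-i)
  ...   | inj₂ (inj₂ cs-i) rewrite cs-i = inj₂ (inj₂ refl)

  is2Cover-φ : toℕ i < toℕ j → Is2Cover a P → Is2Cover a P′
  is2Cover-φ i<j cover r c s c<ar s<ar = by-column (c ≟ i) (c ≟ j)
    where
    by-column : Dec (c ≡ i) → Dec (c ≡ j) → Covers P′ r c s
    by-column (yes refl) _ =
      covers-φ-at-i r s (cover r i s c<ar s<ar) λ j<ar → cover r j s j<ar s<ar
    by-column (no _) (yes refl) =
      covers-φ-at-j r s c<ar (cover r j s c<ar s<ar) (cover r i s (<-trans i<j c<ar) s<ar)
    by-column (no c≢i) (no c≢j)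
      rewrite rc-φ-off r c c≢i c≢j | cs-φ-off c s c≢i c≢j = cover r c s c<ar s<ar

lemma4p1 : (m : ℕ) (a : Fin m → ℕ) → NonIncreasing a →
    (P : PairSet m (width m a)) (i j : Fin (width m a)) → toℕ i < toℕ j →
    (size (φ a i j P) ≡ size P) × (Is2Cover a P → Is2Cover a (φ a i j P))
lemma4p1 m a _ P i j i<j = size-φ a P (<⇒≢ i<j) , is2Cover-φ a P (<⇒≢ i<j) i<j
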